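{- Let $r=r(q)$ be a positive integer with $r=(1-o(1))q$ as $q\to\infty$. Then for every projective plane $\Pi_q$ of order $q$, $$m_r(\Pi_q)=(1-o(1))q^2 \qquad (q\to\infty).$$
   Context: A finite projective plane $\Pi_q$ of order $q\ge 2$ has $q^2+q+1$ points and $q^2+q+1$ lines; every line contains $q+1$ points, every point lies on $q+1$ lines, any two lines meet in exactly one point and any two points lie on exactly one line. $r$-neighbor line percolation on $\Pi_q$: for a set $A$ of points let $A^0=A$ and for $s\ge1$ let $A^s=A^{s-1}\cup\{P: \exists \text{ line } l \ni P \text{ with } |l\cap A^{s-1}|\ge r\}$. The closure of $A$ is $A^k$ for $k$ with $A^k=A^{k+1}$. $A$ percolates if its closure is the whole point set. $m_r(\Pi_q)$ denotes the minimum size of a percolating set in $\Pi_q$. -}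

module Defs where

open import Data.Nat using (ℕ; zero; suc; _+_; _*_; _≤_; _≤ᵇ_)
open import Data.Bool using (Bool; true; false; _∧_; _∨_)
open import Data.Fin using (Fin)
open import Data.Fin.Subset using (Subset; ∣_∣; _∩_; ⊤)
open import Data.Vec using (tabulate; lookup)
open import Data.List using (allFin)
open import Data.Bool.ListAction using (any)
open import Data.Product using (Σ; _×_; ∃-syntax)
open import Relation.Binary.PropositionalEquality using (_≡_; _≢_)
open import Relation.Nullary using (¬_)

N : ℕ → ℕ
N q = q * q + q + 1

record ProjectivePlane (q : ℕ) : Set where
  field
    inc : Fin (N q) → Fin (N q) → Bool

  pointsOn : Fin (N q) → Subset (N q)
  pointsOn l = tabulate (λ P → inc P l)

  linesThrough : Fin (N q) → Subset (N q)
  linesThrough P = tabulate (λ l → inc P l)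

  field
    line-size  : ∀ l → ∣ pointsOn l ∣ ≡ suc q
    point-deg  : ∀ P → ∣ linesThrough P ∣ ≡ suc q
    lines-meet : ∀ l l′ → l ≢ l′ →
      Σ (Fin (N q)) λ P → (inc P l ≡ true × inc P l′ ≡ true) ×
        (∀ P′ → inc P′ l ≡ true → inc P′ l′ ≡ true → P′ ≡ P)
    points-join : ∀ P P′ → P ≢ P′ →
      Σ (Fin (N q)) λ l → (inc P l ≡ true × inc P′ l ≡ true) ×
        (∀ l′ → inc P l′ ≡ true → inc P′ l′ ≡ true → l′ ≡ l)

module _ {q : ℕ} (Π : ProjectivePlane q) (r : ℕ) where
  open ProjectivePlane Π

  step : Subset (N q) → Subset (N q)
  step A = tabulate λ P →
    lookup A P ∨ any (λ l → inc P l ∧ (r ≤ᵇ ∣ pointsOn l ∩ A ∣)) (allFin (N q))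

  iter : ℕ → Subset (N q) → Subset (N q)
  iter zero    A = A
  iter (suc s) A = step (iter s A)

  Percolates : Subset (N q) → Set
  Percolates A = ∃[ s ] iter s A ≡ ⊤

  IsMinPercolatingSize : ℕ → Set
  IsMinPercolatingSize m =
    (∃[ A ] (Percolates A × ∣ A ∣ ≡ m)) ×
    (∀ A → Percolates A → m ≤ ∣ A ∣)

-- Write δ = q + 1 − r, so that a line is active for X (meets X in at least r points) exactly when
-- it misses at most δ points of X.  The potential ∣X∣ + Σₗ min(missingₗ X, δ) does not increase
-- under a percolation step: each newly covered point is charged to an active line through it, and
-- every active line is fully covered afterwards.  So at every stage the covered set exceeds ∣A∣
-- by at most δ per active line.  Conversely, when u points are uncovered an average line misses
-- about u/q of them while an active line misses at most δ; the second moment of the number of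
-- missing points per line, computed exactly by counting pairs of uncovered points through the
-- unique line joining them, shows that only O(q³/u) lines are active.  At the last stage with at
-- least s₀ ≈ 8(k+1)δq uncovered points this gives q² ≲ ∣A∣ + δq³/s₀ + s₀, and both error terms
-- are o(q²) because δ = o(q).
module Submission where

open import Defs
open import Data.Bool using (Bool; true; false; _∧_; _∨_; not; if_then_else_; T)
open import Data.Bool.Properties using (∧-identityʳ; ∧-idem; ∨-zeroʳ)
open import Data.Bool.ListAction using (any)
open import Data.Empty using (⊥-elim)
open import Data.Fin using (Fin; zero; suc)
open import Data.Fin.Properties using (_≟_)
open import Data.Fin.Subset using (Subset; ∣_∣; _∩_; ⊤)
open import Data.Fin.Subset.Properties using (∣⊤∣≡n)
open import Data.List using (allFin; tabulate)
open import Data.Nat using (ℕ; zero; suc; _+_; _*_; _∸_; _⊓_; _≤_; _<_; _≤ᵇ_; _≤?_; z≤n; s≤s)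
open import Data.Nat.Properties hiding (_≟_)
open import Data.Nat.Tactic.RingSolver using (solve-∀)
open import Data.Product using (_×_; _,_; ∃-syntax; proj₁; proj₂)
open import Data.Sum using (_⊎_; inj₁; inj₂)
open import Data.Unit using (tt)
open import Data.Vec using ([]; _∷_; lookup)
open import Data.Vec.Properties using (lookup∘tabulate; lookup-zipWith; lookup-replicate)
open import Function using (_∘_)
open import Relation.Binary.PropositionalEquality
open import Relation.Nullary using (yes; no; does)
open import Algebra.Properties.Semiring.Sum +-*-semiring
  using (sum; sum-syntax; sum-cong-≗; ∑-distrib-+; ∑-comm; *-distribˡ-sum; *-distribʳ-sum)

𝟙 : Bool → ℕ
𝟙 true  = 1
𝟙 false = 0

𝟙-∧ : ∀ a b → 𝟙 (a ∧ b) ≡ 𝟙 a * 𝟙 b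
𝟙-∧ true  b = sym (+-identityʳ (𝟙 b))
𝟙-∧ false b = refl

𝟙-idem : ∀ b → 𝟙 b * 𝟙 b ≡ 𝟙 b
𝟙-idem true  = refl
𝟙-idem false = refl

𝟙+𝟙-not : ∀ b → 𝟙 b + 𝟙 (not b) ≡ 1
𝟙+𝟙-not true  = refl
𝟙+𝟙-not false = refl

𝟙-∧+𝟙-∧-not : ∀ a b → 𝟙 (a ∧ b) + 𝟙 (a ∧ not b) ≡ 𝟙 a
𝟙-∧+𝟙-∧-not true  b = 𝟙+𝟙-not b
𝟙-∧+𝟙-∧-not false b = refl

∑-mono-≤ : ∀ {n} {f g : Fin n → ℕ} → (∀ i → f i ≤ g i) → ∑[ i < n ] f i ≤ ∑[ i < n ] g i
∑-mono-≤ {zero}  f≤g = z≤n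
∑-mono-≤ {suc n} f≤g = +-mono-≤ (f≤g zero) (∑-mono-≤ (f≤g ∘ suc))

∑-const : ∀ n c → ∑[ i < n ] c ≡ n * c
∑-const zero    c = refl
∑-const (suc n) c = cong (c +_) (∑-const n c)

∑-zero : ∀ {n} {f : Fin n → ℕ} → (∀ i → f i ≡ 0) → ∑[ i < n ] f i ≡ 0
∑-zero {n} f≡0 = trans (sum-cong-≗ f≡0) (trans (∑-const n 0) (*-zeroʳ n))

∑*∑ : ∀ {m n} (f : Fin m → ℕ) (g : Fin n → ℕ) →
  (∑[ i < m ] f i) * (∑[ j < n ] g j) ≡ ∑[ i < m ] ∑[ j < n ] (f i * g j)
∑*∑ f g = trans (*-distribʳ-sum (sum g) f) (sum-cong-≗ λ i → *-distribˡ-sum (f i) g)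

∑-𝟙≟-* : ∀ {n} (i : Fin n) (g : Fin n → ℕ) → ∑[ j < n ] (𝟙 (does (i ≟ j)) * g j) ≡ g i
∑-𝟙≟-* {suc n} zero    g = trans (cong₂ _+_ (+-identityʳ (g zero)) (∑-zero {n} (λ _ → refl))) (+-identityʳ (g zero))
∑-𝟙≟-* {suc n} (suc i) g = ∑-𝟙≟-* {n} i (g ∘ suc)

𝟙-any-tabulate : ∀ {A : Set} {n} (g : A → Bool) (f : Fin n → A) →
  𝟙 (any g (tabulate f)) ≤ ∑[ i < n ] 𝟙 (g (f i))
𝟙-any-tabulate {n = zero}  g f = z≤n
𝟙-any-tabulate {n = suc n} g f with g (f zero)
... | true  = s≤s z≤n
... | false = 𝟙-any-tabulate g (f ∘ suc)

any-tabulate-true : ∀ {A : Set} {n} (g : A → Bool) (f : Fin n → A) i →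
  g (f i) ≡ true → any g (tabulate f) ≡ true
any-tabulate-true g f zero    gfi rewrite gfi = refl
any-tabulate-true g f (suc i) gfi rewrite any-tabulate-true g (f ∘ suc) i gfi with g (f zero)
... | true  = refl
... | false = refl

∣∣≡∑𝟙 : ∀ {n} (X : Subset n) → ∣ X ∣ ≡ ∑[ i < n ] 𝟙 (lookup X i)
∣∣≡∑𝟙 []          = refl
∣∣≡∑𝟙 (true ∷ X)  = cong suc (∣∣≡∑𝟙 X)
∣∣≡∑𝟙 (false ∷ X) = ∣∣≡∑𝟙 X

[m∸n]*[m∸n]+2*m*n≤m*m+n*n : ∀ m n → (m ∸ n) * (m ∸ n) + 2 * m * n ≤ m * m + n * n
[m∸n]*[m∸n]+2*m*n≤m*m+n*n m n with ≤-total n m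
... | inj₁ n≤m with m≤n⇒∃[o]m+o≡n n≤m
...   | d , refl rewrite m+n∸m≡n n d = ≤-reflexive (expand n d)
  where
  expand : ∀ n d → d * d + 2 * (n + d) * n ≡ (n + d) * (n + d) + n * n
  expand = solve-∀
[m∸n]*[m∸n]+2*m*n≤m*m+n*n m n | inj₂ m≤n rewrite m≤n⇒m∸n≡0 m≤n with m≤n⇒∃[o]m+o≡n m≤n
... | d , refl = ≤-trans (≤-reflexive (expand m d)) (≤-trans (m≤n+m _ (d * d)) (≤-reflexive (regroup m d)))
  where
  expand : ∀ m d → 2 * m * (m + d) ≡ 2 * m * m + 2 * m * d
  expand = solve-∀
  regroup : ∀ m d → d * d + (2 * m * m + 2 * m * d) ≡ m * m + (m + d) * (m + d)
  regroup = solve-∀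

variance-arith : ∀ {q} L D u → 1 ≤ q →
  L * D + 2 * u * q * (u * suc q) ≤ N q * (u * u) + q * q * (u * u + q * u) →
  L * D ≤ q * q * q * u
variance-arith {zero}  _ _ _ ()
variance-arith {suc p} L D u _ h = ≤-trans (m≤m+n (L * D) (p * (u * u)))
  (+-cancelʳ-≤ Z (L * D + p * (u * u)) (suc p * suc p * suc p * u)
    (≤-trans (≤-reflexive (lhs p L D u)) (≤-trans h (≤-reflexive (rhs p u)))))
  where
  Z = 2 * suc p * suc p * (u * u) + p * (u * u) + 2 * (u * u)
  lhs : ∀ p L D u → L * D + p * (u * u) + (2 * suc p * suc p * (u * u) + p * (u * u) + 2 * (u * u))
                  ≡ L * D + 2 * u * suc p * (u * suc (suc p))
  lhs = solve-∀
  rhs : ∀ p u → (suc p * suc p + suc p + 1) * (u * u) + suc p * suc p * (u * u + suc p * u)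
              ≡ suc p * suc p * suc p * u + (2 * suc p * suc p * (u * u) + p * (u * u) + 2 * (u * u))
  rhs = solve-∀

first-drop-below : ∀ (f : ℕ → ℕ) s₀ S → f S < s₀ → f 0 < s₀ ⊎ ∃[ t ] (s₀ ≤ f t × f (suc t) < s₀)
first-drop-below f s₀ zero    fS<s₀ = inj₁ fS<s₀
first-drop-below f s₀ (suc S) fS<s₀ with s₀ ≤? f S
... | yes s₀≤fS = inj₂ (S , s₀≤fS , fS<s₀)
... | no  s₀≰fS = first-drop-below f s₀ S (≰⇒> s₀≰fS)

module Percolation {q : ℕ} (Π : ProjectivePlane q) (r : ℕ) where
  open ProjectivePlane Π
  open ≤-Reasoning

  δ : ℕ
  δ = suc q ∸ r

  active : Subset (N q) → Fin (N q) → Bool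
  active X l = r ≤ᵇ ∣ pointsOn l ∩ X ∣

  activeLines : Subset (N q) → ℕ
  activeLines X = ∑[ l < N q ] 𝟙 (active X l)

  missing : Fin (N q) → Subset (N q) → ℕ
  missing l X = ∑[ P < N q ] 𝟙 (inc P l ∧ not (lookup X P))

  uncovered : Subset (N q) → ℕ
  uncovered X = ∑[ P < N q ] 𝟙 (not (lookup X P))

  ∑-line : ∀ l → ∑[ P < N q ] 𝟙 (inc P l) ≡ suc q
  ∑-line l = trans (sym (trans (∣∣≡∑𝟙 (pointsOn l)) (sum-cong-≗ {N q} λ P → cong 𝟙 (lookup∘tabulate _ P))))
                   (line-size l)

  ∑-pencil : ∀ P → ∑[ l < N q ] 𝟙 (inc P l) ≡ suc q
  ∑-pencil P = trans (sym (trans (∣∣≡∑𝟙 (linesThrough P)) (sum-cong-≗ {N q} λ l → cong 𝟙 (lookup∘tabulate _ l))))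
                     (point-deg P)

  ∣pointsOn∩∣≡∑ : ∀ l X → ∣ pointsOn l ∩ X ∣ ≡ ∑[ P < N q ] 𝟙 (inc P l ∧ lookup X P)
  ∣pointsOn∩∣≡∑ l X = trans (∣∣≡∑𝟙 (pointsOn l ∩ X)) (sum-cong-≗ {N q} λ P → cong 𝟙
    (trans (lookup-zipWith _∧_ P (pointsOn l) X) (cong (_∧ lookup X P) (lookup∘tabulate _ P))))

  ∣pointsOn∩∣+missing : ∀ l X → ∣ pointsOn l ∩ X ∣ + missing l X ≡ suc q
  ∣pointsOn∩∣+missing l X = begin-equality
    ∣ pointsOn l ∩ X ∣ + missing l X
      ≡⟨ cong (_+ missing l X) (∣pointsOn∩∣≡∑ l X) ⟩
    ∑[ P < N q ] 𝟙 (inc P l ∧ lookup X P) + missing l X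
      ≡⟨ sym (∑-distrib-+ {N q} _ _) ⟩
    ∑[ P < N q ] (𝟙 (inc P l ∧ lookup X P) + 𝟙 (inc P l ∧ not (lookup X P)))
      ≡⟨ sum-cong-≗ {N q} (λ P → 𝟙-∧+𝟙-∧-not (inc P l) (lookup X P)) ⟩
    ∑[ P < N q ] 𝟙 (inc P l)
      ≡⟨ ∑-line l ⟩
    suc q ∎

  ∣∣+uncovered : ∀ X → ∣ X ∣ + uncovered X ≡ N q
  ∣∣+uncovered X = begin-equality
    ∣ X ∣ + uncovered X                           ≡⟨ cong (_+ uncovered X) (∣∣≡∑𝟙 X) ⟩
    ∑[ P < N q ] 𝟙 (lookup X P) + uncovered X     ≡⟨ sym (∑-distrib-+ {N q} _ _) ⟩
    ∑[ P < N q ] (𝟙 (lookup X P) + 𝟙 (not (lookup X P)))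
                                                  ≡⟨ sum-cong-≗ {N q} (λ P → 𝟙+𝟙-not (lookup X P)) ⟩
    ∑[ P < N q ] 1                                ≡⟨ trans (∑-const (N q) 1) (*-identityʳ (N q)) ⟩
    N q                                           ∎

  missing≡ : ∀ l X → missing l X ≡ suc q ∸ ∣ pointsOn l ∩ X ∣
  missing≡ l X = trans (sym (m+n∸m≡n ∣ pointsOn l ∩ X ∣ (missing l X)))
                       (cong (_∸ ∣ pointsOn l ∩ X ∣) (∣pointsOn∩∣+missing l X))

  missing≤δ : ∀ {X l} → active X l ≡ true → missing l X ≤ δ
  missing≤δ {X} {l} act = begin
    missing l X                 ≡⟨ missing≡ l X ⟩
    suc q ∸ ∣ pointsOn l ∩ X ∣  ≤⟨ ∸-monoʳ-≤ (suc q) (≤ᵇ⇒≤ r _ (subst T (sym act) tt)) ⟩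
    δ                           ∎

  δ≤missing : ∀ {X l} → active X l ≡ false → δ ≤ missing l X
  δ≤missing {X} {l} inact = begin
    δ                           ≤⟨ ∸-monoʳ-≤ (suc q) (<⇒≤ (≰⇒> (λ (r≤ : r ≤ ∣ pointsOn l ∩ X ∣) → subst T inact (≤⇒≤ᵇ r≤)))) ⟩
    suc q ∸ ∣ pointsOn l ∩ X ∣  ≡⟨ missing≡ l X ⟨
    missing l X                 ∎

  lookup-step : ∀ X P →
    lookup (step Π r X) P ≡ (lookup X P ∨ any (λ l → inc P l ∧ active X l) (allFin (N q)))
  lookup-step X P = lookup∘tabulate _ P

  covered-after-step : ∀ {X l P} → active X l ≡ true → inc P l ≡ true → lookup (step Π r X) P ≡ true
  covered-after-step {X} {l} {P} act P∈l
    rewrite lookup-step X P | any-tabulate-true (λ l → inc P l ∧ active X l) (λ l → l) l (cong₂ _∧_ P∈l act)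
    = ∨-zeroʳ (lookup X P)

  missing-after-step : ∀ {X l} → active X l ≡ true → missing l (step Π r X) ≡ 0
  missing-after-step {X} {l} act = ∑-zero {N q} λ P → on-line P (inc P l) refl
    where
    on-line : ∀ P b → inc P l ≡ b → 𝟙 (b ∧ not (lookup (step Π r X) P)) ≡ 0
    on-line P false _   = refl
    on-line P true  P∈l rewrite covered-after-step act P∈l = refl

  ∣step∣≤ : ∀ X → ∣ step Π r X ∣ ≤ ∣ X ∣ + ∑[ l < N q ] (𝟙 (active X l) * missing l X)
  ∣step∣≤ X = begin
    ∣ step Π r X ∣
      ≡⟨ ∣∣≡∑𝟙 (step Π r X) ⟩
    ∑[ P < N q ] 𝟙 (lookup (step Π r X) P)
      ≤⟨ ∑-mono-≤ newly-covered ⟩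
    ∑[ P < N q ] (𝟙 (lookup X P) + ∑[ l < N q ] (𝟙 (active X l) * 𝟙 (inc P l ∧ not (lookup X P))))
      ≡⟨ ∑-distrib-+ {N q} _ _ ⟩
    ∑[ P < N q ] 𝟙 (lookup X P) + ∑[ P < N q ] ∑[ l < N q ] (𝟙 (active X l) * 𝟙 (inc P l ∧ not (lookup X P)))
      ≡⟨ cong₂ _+_ (sym (∣∣≡∑𝟙 X)) (∑-comm {N q} {N q} _) ⟩
    ∣ X ∣ + ∑[ l < N q ] ∑[ P < N q ] (𝟙 (active X l) * 𝟙 (inc P l ∧ not (lookup X P)))
      ≡⟨ cong (∣ X ∣ +_) (sum-cong-≗ {N q} λ l → sym (*-distribˡ-sum {N q} (𝟙 (active X l)) _)) ⟩
    ∣ X ∣ + ∑[ l < N q ] (𝟙 (active X l) * missing l X) ∎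
    where
    newly-covered : ∀ P → 𝟙 (lookup (step Π r X) P) ≤
      𝟙 (lookup X P) + ∑[ l < N q ] (𝟙 (active X l) * 𝟙 (inc P l ∧ not (lookup X P)))
    newly-covered P rewrite lookup-step X P with lookup X P
    ... | true  = s≤s z≤n
    ... | false = ≤-trans (𝟙-any-tabulate {n = N q} _ (λ l → l)) (≤-reflexive (sum-cong-≗ {N q} λ l → begin-equality
      𝟙 (inc P l ∧ active X l)             ≡⟨ 𝟙-∧ (inc P l) (active X l) ⟩
      𝟙 (inc P l) * 𝟙 (active X l)         ≡⟨ *-comm (𝟙 (inc P l)) _ ⟩
      𝟙 (active X l) * 𝟙 (inc P l)         ≡⟨ cong (λ b → 𝟙 (active X l) * 𝟙 b) (∧-identityʳ (inc P l)) ⟨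
      𝟙 (active X l) * 𝟙 (inc P l ∧ true) ∎))

  potential : Subset (N q) → ℕ
  potential X = ∣ X ∣ + ∑[ l < N q ] (missing l X ⊓ δ)

  idle : Subset (N q) → Fin (N q) → ℕ
  idle X l = if active X l then 0 else δ

  capped-missing-split : ∀ X l → 𝟙 (active X l) * missing l X + idle X l ≡ missing l X ⊓ δ
  capped-missing-split X l with active X l in act
  ... | true  = trans (+-identityʳ _) (trans (+-identityʳ _) (sym (m≤n⇒m⊓n≡m (missing≤δ act))))
  ... | false = sym (m≥n⇒m⊓n≡n (δ≤missing act))

  capped-missing-after-step : ∀ X l → missing l (step Π r X) ⊓ δ ≤ idle X l
  capped-missing-after-step X l with active X l in act
  ... | true  = ≤-trans (m⊓n≤m _ δ) (≤-reflexive (missing-after-step act))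
  ... | false = m⊓n≤n _ δ

  ∑-idle : ∀ X → ∑[ l < N q ] idle X l + δ * activeLines X ≡ N q * δ
  ∑-idle X = begin-equality
    ∑[ l < N q ] idle X l + δ * activeLines X
      ≡⟨ cong (∑[ l < N q ] idle X l +_) (*-distribˡ-sum {N q} δ _) ⟩
    ∑[ l < N q ] idle X l + ∑[ l < N q ] (δ * 𝟙 (active X l))
      ≡⟨ ∑-distrib-+ {N q} _ _ ⟨
    ∑[ l < N q ] (idle X l + δ * 𝟙 (active X l))
      ≡⟨ sum-cong-≗ {N q} (λ l → idle+δ*𝟙 (active X l)) ⟩
    ∑[ l < N q ] δ
      ≡⟨ ∑-const (N q) δ ⟩
    N q * δ ∎
    where
    idle+δ*𝟙 : ∀ a → (if a then 0 else δ) + δ * 𝟙 a ≡ δ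
    idle+δ*𝟙 true  = *-identityʳ δ
    idle+δ*𝟙 false = trans (cong (δ +_) (*-zeroʳ δ)) (+-identityʳ δ)

  ∣step∣+∑idle≤potential : ∀ X → ∣ step Π r X ∣ + ∑[ l < N q ] idle X l ≤ potential X
  ∣step∣+∑idle≤potential X = begin
    ∣ step Π r X ∣ + ∑[ l < N q ] idle X l
      ≤⟨ +-monoˡ-≤ _ (∣step∣≤ X) ⟩
    ∣ X ∣ + ∑[ l < N q ] (𝟙 (active X l) * missing l X) + ∑[ l < N q ] idle X l
      ≡⟨ +-assoc ∣ X ∣ _ _ ⟩
    ∣ X ∣ + (∑[ l < N q ] (𝟙 (active X l) * missing l X) + ∑[ l < N q ] idle X l)
      ≡⟨ cong (∣ X ∣ +_) (trans (sym (∑-distrib-+ {N q} _ _)) (sum-cong-≗ {N q} (capped-missing-split X))) ⟩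
    potential X ∎

  potential-step : ∀ X → potential (step Π r X) ≤ potential X
  potential-step X = ≤-trans (+-monoʳ-≤ ∣ step Π r X ∣ (∑-mono-≤ (capped-missing-after-step X)))
                             (∣step∣+∑idle≤potential X)

  potential-iter : ∀ A t → potential (iter Π r t A) ≤ potential A
  potential-iter A zero    = ≤-refl
  potential-iter A (suc t) = ≤-trans (potential-step (iter Π r t A)) (potential-iter A t)

  potential≤ : ∀ A → potential A ≤ ∣ A ∣ + N q * δ
  potential≤ A = +-monoʳ-≤ ∣ A ∣ (≤-trans (∑-mono-≤ (λ l → m⊓n≤n (missing l A) δ)) (≤-reflexive (∑-const (N q) δ)))

  ∣step-iter∣≤ : ∀ A t → ∣ step Π r (iter Π r t A) ∣ ≤ ∣ A ∣ + δ * activeLines (iter Π r t A)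
  ∣step-iter∣≤ A t = +-cancelʳ-≤ I _ _ (begin
    ∣ step Π r X ∣ + I                 ≤⟨ ∣step∣+∑idle≤potential X ⟩
    potential X                        ≤⟨ potential-iter A t ⟩
    potential A                        ≤⟨ potential≤ A ⟩
    ∣ A ∣ + N q * δ                    ≡⟨ cong (∣ A ∣ +_) (∑-idle X) ⟨
    ∣ A ∣ + (I + δ * activeLines X)    ≡⟨ cong (∣ A ∣ +_) (+-comm I _) ⟩
    ∣ A ∣ + (δ * activeLines X + I)    ≡⟨ +-assoc ∣ A ∣ _ I ⟨
    ∣ A ∣ + δ * activeLines X + I      ∎)
    where
    X = iter Π r t A
    I = ∑[ l < N q ] idle X l

  ∑-missing : ∀ X → ∑[ l < N q ] missing l X ≡ uncovered X * suc q
  ∑-missing X = begin-equality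
    ∑[ l < N q ] ∑[ P < N q ] 𝟙 (inc P l ∧ not (lookup X P))
      ≡⟨ ∑-comm {N q} {N q} _ ⟩
    ∑[ P < N q ] ∑[ l < N q ] 𝟙 (inc P l ∧ not (lookup X P))
      ≡⟨ sum-cong-≗ {N q} (λ P → sum-cong-≗ {N q} λ l →
           trans (𝟙-∧ (inc P l) _) (*-comm (𝟙 (inc P l)) _)) ⟩
    ∑[ P < N q ] ∑[ l < N q ] (𝟙 (not (lookup X P)) * 𝟙 (inc P l))
      ≡⟨ sum-cong-≗ {N q} (λ P →
           trans (sym (*-distribˡ-sum {N q} (𝟙 (not (lookup X P))) _)) (cong (𝟙 (not (lookup X P)) *_) (∑-pencil P))) ⟩
    ∑[ P < N q ] (𝟙 (not (lookup X P)) * suc q)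
      ≡⟨ *-distribʳ-sum {N q} (suc q) _ ⟨
    uncovered X * suc q ∎

  commonLines : Fin (N q) → Fin (N q) → ℕ
  commonLines P P′ = ∑[ l < N q ] 𝟙 (inc P l ∧ inc P′ l)

  commonLines≡ : ∀ P P′ → commonLines P P′ ≡ 1 + 𝟙 (does (P ≟ P′)) * q
  commonLines≡ P P′ with P ≟ P′
  ... | yes refl = trans (sum-cong-≗ {N q} (λ l → cong 𝟙 (∧-idem (inc P l))))
                         (trans (∑-pencil P) (cong suc (sym (+-identityʳ q))))
  ... | no P≢P′ with points-join P P′ P≢P′
  ...   | l₀ , (P∈l₀ , P′∈l₀) , unique =
    trans (sum-cong-≗ {N q} on-joining-line) (∑-𝟙≟-* l₀ (λ _ → 1))
    where
    on-joining-line : ∀ l → 𝟙 (inc P l ∧ inc P′ l) ≡ 𝟙 (does (l₀ ≟ l)) * 1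
    on-joining-line l with l₀ ≟ l
    ... | yes refl rewrite P∈l₀ | P′∈l₀ = refl
    ... | no l₀≢l with inc P l in P∈l | inc P′ l in P′∈l
    ...   | true  | true  = ⊥-elim (l₀≢l (sym (unique l P∈l P′∈l)))
    ...   | true  | false = refl
    ...   | false | _     = refl

  ∑-missing² : ∀ X →
    ∑[ l < N q ] (missing l X * missing l X) ≡ uncovered X * uncovered X + q * uncovered X
  ∑-missing² X = begin-equality
    ∑[ l < N q ] (missing l X * missing l X)
      ≡⟨ sum-cong-≗ {N q} (λ l → ∑*∑ (f l) (f l)) ⟩
    ∑[ l < N q ] ∑[ P < N q ] ∑[ P′ < N q ] (f l P * f l P′)
      ≡⟨ ∑-comm {N q} {N q} _ ⟩
    ∑[ P < N q ] ∑[ l < N q ] ∑[ P′ < N q ] (f l P * f l P′)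
      ≡⟨ sum-cong-≗ {N q} (λ P → ∑-comm {N q} {N q} _) ⟩
    ∑[ P < N q ] ∑[ P′ < N q ] ∑[ l < N q ] (f l P * f l P′)
      ≡⟨ sum-cong-≗ {N q} (λ P → sum-cong-≗ {N q} (pair P)) ⟩
    ∑[ P < N q ] ∑[ P′ < N q ] (c P * c P′ + 𝟙 (does (P ≟ P′)) * (q * (c P * c P′)))
      ≡⟨ sum-cong-≗ {N q} (λ P → trans (∑-distrib-+ {N q} _ _)
           (cong₂ _+_ (sym (*-distribˡ-sum {N q} (c P) c)) (∑-𝟙≟-* P _))) ⟩
    ∑[ P < N q ] (c P * uncovered X + q * (c P * c P))
      ≡⟨ sum-cong-≗ {N q} (λ P → cong (λ z → c P * uncovered X + q * z) (𝟙-idem _)) ⟩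
    ∑[ P < N q ] (c P * uncovered X + q * c P)
      ≡⟨ trans (∑-distrib-+ {N q} _ _)
           (cong₂ _+_ (sym (*-distribʳ-sum {N q} (uncovered X) c)) (sym (*-distribˡ-sum {N q} q c))) ⟩
    uncovered X * uncovered X + q * uncovered X ∎
    where
    c : Fin (N q) → ℕ
    c P = 𝟙 (not (lookup X P))
    f : Fin (N q) → Fin (N q) → ℕ
    f l P = 𝟙 (inc P l ∧ not (lookup X P))
    regroup : ∀ a x b y → 𝟙 (a ∧ not x) * 𝟙 (b ∧ not y) ≡ 𝟙 (not x) * 𝟙 (not y) * 𝟙 (a ∧ b)
    regroup a x b y rewrite 𝟙-∧ a (not x) | 𝟙-∧ b (not y) | 𝟙-∧ a b =
      reorder (𝟙 a) (𝟙 (not x)) (𝟙 b) (𝟙 (not y))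
      where
      reorder : ∀ a x b y → a * x * (b * y) ≡ x * y * (a * b)
      reorder = solve-∀
    distribute : ∀ m e q → m * (1 + e * q) ≡ m + e * (q * m)
    distribute = solve-∀
    pair : ∀ P P′ → ∑[ l < N q ] (f l P * f l P′) ≡ c P * c P′ + 𝟙 (does (P ≟ P′)) * (q * (c P * c P′))
    pair P P′ = begin-equality
      ∑[ l < N q ] (f l P * f l P′)
        ≡⟨ sum-cong-≗ {N q} (λ l → regroup (inc P l) (lookup X P) (inc P′ l) (lookup X P′)) ⟩
      ∑[ l < N q ] (c P * c P′ * 𝟙 (inc P l ∧ inc P′ l))
        ≡⟨ *-distribˡ-sum {N q} (c P * c P′) _ ⟨
      c P * c P′ * commonLines P P′
        ≡⟨ cong (c P * c P′ *_) (commonLines≡ P P′) ⟩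
      c P * c P′ * (1 + 𝟙 (does (P ≟ P′)) * q)
        ≡⟨ distribute (c P * c P′) (𝟙 (does (P ≟ P′))) q ⟩
      c P * c P′ + 𝟙 (does (P ≟ P′)) * (q * (c P * c P′)) ∎

  line-deviation : ∀ X l →
    𝟙 (active X l) * ((uncovered X ∸ q * δ) * (uncovered X ∸ q * δ)) + 2 * uncovered X * q * missing l X
      ≤ uncovered X * uncovered X + q * q * (missing l X * missing l X)
  line-deviation X l = begin
    𝟙 (active X l) * (D * D) + 2 * u * q * m   ≤⟨ +-monoˡ-≤ _ active-term ⟩
    (u ∸ q * m) * (u ∸ q * m) + 2 * u * q * m  ≡⟨ cong ((u ∸ q * m) * (u ∸ q * m) +_) (*-assoc (2 * u) q m) ⟩
    (u ∸ q * m) * (u ∸ q * m) + 2 * u * (q * m) ≤⟨ [m∸n]*[m∸n]+2*m*n≤m*m+n*n u (q * m) ⟩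
    u * u + q * m * (q * m)                     ≡⟨ cong (u * u +_) (square-product q m) ⟩
    u * u + q * q * (m * m)                     ∎
    where
    u = uncovered X
    m = missing l X
    D = u ∸ q * δ
    square-product : ∀ q m → q * m * (q * m) ≡ q * q * (m * m)
    square-product = solve-∀
    active-term : 𝟙 (active X l) * (D * D) ≤ (u ∸ q * m) * (u ∸ q * m)
    active-term with active X l in act
    ... | true  = ≤-trans (≤-reflexive (*-identityˡ _)) (*-mono-≤ D≤ D≤)
      where
      D≤ : D ≤ u ∸ q * m
      D≤ = ∸-monoʳ-≤ u (*-monoʳ-≤ q (missing≤δ act))
    ... | false = z≤n

  activeLines-bound : 1 ≤ q → ∀ X →
    activeLines X * ((uncovered X ∸ q * δ) * (uncovered X ∸ q * δ)) ≤ q * q * q * uncovered X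
  activeLines-bound 1≤q X = variance-arith (activeLines X) DD u 1≤q (begin
    activeLines X * DD + 2 * u * q * (u * suc q)
      ≡⟨ cong₂ _+_ (*-distribʳ-sum {N q} DD _) (cong (2 * u * q *_) (sym (∑-missing X))) ⟩
    ∑[ l < N q ] (𝟙 (active X l) * DD) + 2 * u * q * ∑[ l < N q ] missing l X
      ≡⟨ cong (∑[ l < N q ] (𝟙 (active X l) * DD) +_) (*-distribˡ-sum {N q} (2 * u * q) _) ⟩
    ∑[ l < N q ] (𝟙 (active X l) * DD) + ∑[ l < N q ] (2 * u * q * missing l X)
      ≡⟨ ∑-distrib-+ {N q} _ _ ⟨
    ∑[ l < N q ] (𝟙 (active X l) * DD + 2 * u * q * missing l X)
      ≤⟨ ∑-mono-≤ (line-deviation X) ⟩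
    ∑[ l < N q ] (u * u + q * q * (missing l X * missing l X))
      ≡⟨ trans (∑-distrib-+ {N q} _ _) (cong₂ _+_ (∑-const (N q) (u * u)) (sym (*-distribˡ-sum {N q} (q * q) _))) ⟩
    N q * (u * u) + q * q * ∑[ l < N q ] (missing l X * missing l X)
      ≡⟨ cong (λ z → N q * (u * u) + q * q * z) (∑-missing² X) ⟩
    N q * (u * u) + q * q * (u * u + q * u) ∎)
    where
    u = uncovered X
    DD = (u ∸ q * δ) * (u ∸ q * δ)

  uncovered-⊤ : uncovered ⊤ ≡ 0
  uncovered-⊤ = ∑-zero {N q} λ P → cong (𝟙 ∘ not) (lookup-replicate P true)

  -- L and u are the numbers of active lines and of uncovered points at the last stage with at
  -- least s₀ uncovered points (L = 0 and u = s₀ if A itself leaves fewer uncovered).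
  percolation-stage : 1 ≤ q → ∀ A → Percolates Π r A → ∀ s₀ → 1 ≤ s₀ →
    ∃[ L ] ∃[ u ] (N q ≤ ∣ A ∣ + δ * L + s₀) × (s₀ ≤ u) ×
                  (L * ((u ∸ q * δ) * (u ∸ q * δ)) ≤ q * q * q * u)
  percolation-stage 1≤q A (S , A^S≡⊤) s₀ 1≤s₀
    with first-drop-below (λ t → uncovered (iter Π r t A)) s₀ S
           (subst (_< s₀) (sym (trans (cong uncovered A^S≡⊤) uncovered-⊤)) 1≤s₀)
  ... | inj₁ u<s₀ = 0 , s₀ , bound , ≤-refl , z≤n
    where
    bound : N q ≤ ∣ A ∣ + δ * 0 + s₀
    bound = begin
      N q                 ≡⟨ ∣∣+uncovered A ⟨
      ∣ A ∣ + uncovered A ≤⟨ +-monoʳ-≤ ∣ A ∣ (<⇒≤ u<s₀) ⟩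
      ∣ A ∣ + s₀          ≡⟨ cong (_+ s₀) (trans (cong (∣ A ∣ +_) (*-zeroʳ δ)) (+-identityʳ ∣ A ∣)) ⟨
      ∣ A ∣ + δ * 0 + s₀  ∎
  ... | inj₂ (t , s₀≤u , u′<s₀) = activeLines X , uncovered X , bound , s₀≤u , activeLines-bound 1≤q X
    where
    X = iter Π r t A
    bound : N q ≤ ∣ A ∣ + δ * activeLines X + s₀
    bound = begin
      N q                                        ≡⟨ ∣∣+uncovered (step Π r X) ⟨
      ∣ step Π r X ∣ + uncovered (step Π r X)    ≤⟨ +-mono-≤ (∣step-iter∣≤ A t) (<⇒≤ u′<s₀) ⟩
      ∣ A ∣ + δ * activeLines X + s₀             ∎

2*n≤m⇒m≤2*[m∸n] : ∀ m n → 2 * n ≤ m → m ≤ 2 * (m ∸ n)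
2*n≤m⇒m≤2*[m∸n] m n 2n≤m with m≤n⇒∃[o]m+o≡n 2n≤m
... | e , refl = ≤-trans (m≤m+n (2 * n + e) e) (≤-reflexive (begin-equality
  2 * n + e + e         ≡⟨ double n e ⟩
  2 * (n + e)           ≡⟨ cong (2 *_) (m+n∸m≡n n (n + e)) ⟨
  2 * (n + (n + e) ∸ n) ≡⟨ cong (λ z → 2 * (z ∸ n)) (split n e) ⟩
  2 * (2 * n + e ∸ n)   ∎))
  where
  open ≤-Reasoning
  double : ∀ n e → 2 * n + e + e ≡ 2 * (n + e)
  double = solve-∀
  split : ∀ n e → n + (n + e) ≡ 2 * n + e
  split = solve-∀

L*u≤4*C : ∀ L u x C → 2 * x ≤ u → L * ((u ∸ x) * (u ∸ x)) ≤ C * u → L * u ≤ 4 * C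
L*u≤4*C L zero    x C _    _ rewrite *-zeroʳ L = z≤n
L*u≤4*C L (suc u) x C 2x≤u h = *-cancelʳ-≤ (L * suc u) (4 * C) (suc u) (begin
  L * suc u * suc u                         ≡⟨ *-assoc L (suc u) (suc u) ⟩
  L * (suc u * suc u)                       ≤⟨ *-monoʳ-≤ L (*-mono-≤ u≤2D u≤2D) ⟩
  L * ((2 * D) * (2 * D))                   ≡⟨ scale L D ⟩
  4 * (L * (D * D))                         ≤⟨ *-monoʳ-≤ 4 h ⟩
  4 * (C * suc u)                           ≡⟨ *-assoc 4 C (suc u) ⟨
  4 * C * suc u                             ∎)
  where
  open ≤-Reasoning
  D = suc u ∸ x
  u≤2D : suc u ≤ 2 * D
  u≤2D = 2*n≤m⇒m≤2*[m∸n] (suc u) x 2x≤u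
  scale : ∀ L D → L * ((2 * D) * (2 * D)) ≡ 4 * (L * (D * D))
  scale = solve-∀

k*n≤[1+k]*a : ∀ k n a x → n ≤ a + x → suc k * x ≤ n → k * n ≤ suc k * a
k*n≤[1+k]*a k n a x n≤a+x kx≤n = +-cancelʳ-≤ n (k * n) (suc k * a) (begin
  k * n + n                 ≡⟨ +-comm (k * n) n ⟩
  suc k * n                 ≤⟨ *-monoʳ-≤ (suc k) n≤a+x ⟩
  suc k * (a + x)           ≡⟨ *-distribˡ-+ (suc k) a x ⟩
  suc k * a + suc k * x     ≤⟨ +-monoʳ-≤ (suc k * a) kx≤n ⟩
  suc k * a + n             ∎)
  where open ≤-Reasoning

k*q²≤[1+k]*a : ∀ k p d a L u →
  16 * suc k * suc k * suc d ≤ suc p →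
  N (suc p) ≤ a + d * L + 8 * suc k * suc d * suc p →
  8 * suc k * suc d * suc p ≤ u →
  L * ((u ∸ suc p * d) * (u ∸ suc p * d)) ≤ suc p * suc p * suc p * u →
  k * (suc p * suc p) ≤ suc k * a
k*q²≤[1+k]*a k p d a L u small cover s₀≤u sparse =
  k*n≤[1+k]*a k (q * q) a (d * L + s₀) q²≤a+x (*-cancelˡ-≤ 2 twice)
  where
  open ≤-Reasoning
  q = suc p
  M = suc k
  s₀ = 8 * M * suc d * q
  q²≤a+x : q * q ≤ a + (d * L + s₀)
  q²≤a+x = ≤-trans (m+n≤o⇒m≤o (q * q) (m+n≤o⇒m≤o (q * q + q) cover)) (≤-reflexive (+-assoc a (d * L) s₀))
  2qd≤s₀ : 2 * (q * d) ≤ s₀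
  2qd≤s₀ = ≤-trans (m≤m+n (2 * (q * d)) _) (≤-reflexive (split k d p))
    where
    split : ∀ k d p → 2 * (suc p * d) + (6 * suc p * d + 8 * k * suc d * suc p + 8 * suc p)
                    ≡ 8 * suc k * suc d * suc p
    split = solve-∀
  M[d+1]L≤q² : 2 * M * suc d * L ≤ q * q
  M[d+1]L≤q² = *-cancelʳ-≤ (2 * M * suc d * L) (q * q) (4 * q) (begin
    2 * M * suc d * L * (4 * q)  ≡⟨ regroup M d L q ⟩
    L * s₀                       ≤⟨ *-monoʳ-≤ L s₀≤u ⟩
    L * u                        ≤⟨ L*u≤4*C L u (q * d) (q * q * q) (≤-trans 2qd≤s₀ s₀≤u) sparse ⟩
    4 * (q * q * q)              ≡⟨ cube q ⟩
    q * q * (4 * q)              ∎)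
    where
    regroup : ∀ M d L q → 2 * M * suc d * L * (4 * q) ≡ L * (8 * M * suc d * q)
    regroup = solve-∀
    cube : ∀ q → 4 * (q * q * q) ≡ q * q * (4 * q)
    cube = solve-∀
  twice : 2 * (M * (d * L + s₀)) ≤ 2 * (q * q)
  twice = begin
    2 * (M * (d * L + s₀))           ≡⟨ expand M d L s₀ ⟩
    2 * M * d * L + 2 * M * s₀       ≤⟨ +-monoˡ-≤ (2 * M * s₀) (*-monoˡ-≤ L (*-monoʳ-≤ (2 * M) (n≤1+n d))) ⟩
    2 * M * suc d * L + 2 * M * s₀   ≤⟨ +-monoˡ-≤ (2 * M * s₀) M[d+1]L≤q² ⟩
    q * q + 2 * M * s₀               ≡⟨ cong (q * q +_) (regroup M d q) ⟩
    q * q + 16 * M * M * suc d * q   ≤⟨ +-monoʳ-≤ (q * q) (*-monoˡ-≤ q small) ⟩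
    q * q + q * q                    ≡⟨ cong (q * q +_) (+-identityʳ (q * q)) ⟨
    2 * (q * q)                      ∎
    where
    expand : ∀ M d L s → 2 * (M * (d * L + s)) ≡ 2 * M * d * L + 2 * M * s
    expand = solve-∀
    regroup : ∀ M d q → 2 * M * (8 * M * suc d * q) ≡ 16 * M * M * suc d * q
    regroup = solve-∀

[1+K]*[[1+q]∸r]≤q+[1+K] : ∀ K q r → K * q ≤ suc K * r → suc K * (suc q ∸ r) ≤ q + suc K
[1+K]*[[1+q]∸r]≤q+[1+K] K q r Kq≤[1+K]r = begin
  suc K * (suc q ∸ r)          ≡⟨ *-distribˡ-∸ (suc K) (suc q) r ⟩
  suc K * suc q ∸ suc K * r    ≤⟨ ∸-monoʳ-≤ (suc K * suc q) Kq≤[1+K]r ⟩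
  suc K * suc q ∸ K * q        ≡⟨ cong (_∸ K * q) (expand K q) ⟩
  K * q + (q + suc K) ∸ K * q  ≡⟨ m+n∸m≡n (K * q) (q + suc K) ⟩
  q + suc K                    ∎
  where
  open ≤-Reasoning
  expand : ∀ K q → suc K * suc q ≡ K * q + (q + suc K)
  expand = solve-∀

deficiency-small : ∀ k q r → 32 * suc k * suc k * q ≤ suc (32 * suc k * suc k) * r →
  2 * suc (32 * suc k * suc k) ≤ q → 16 * suc k * suc k * suc (suc q ∸ r) ≤ q
deficiency-small k q r Kq≤[1+K]r 2[1+K]≤q = *-cancelˡ-≤ (suc K) (begin
  suc K * (16 * M * M * suc d)       ≡⟨ expand K M d ⟩
  16 * M * M * (suc K * d + suc K)   ≤⟨ *-monoʳ-≤ (16 * M * M) (+-monoˡ-≤ (suc K) ([1+K]*[[1+q]∸r]≤q+[1+K] K q r Kq≤[1+K]r)) ⟩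
  16 * M * M * (q + suc K + suc K)   ≡⟨ cong (16 * M * M *_) (regroup q (suc K)) ⟩
  16 * M * M * (q + 2 * suc K)       ≤⟨ *-monoʳ-≤ (16 * M * M) (+-monoʳ-≤ q 2[1+K]≤q) ⟩
  16 * M * M * (q + q)               ≡⟨ double M q ⟩
  K * q                              ≤⟨ *-monoˡ-≤ q (n≤1+n K) ⟩
  suc K * q                          ∎)
  where
  open ≤-Reasoning
  M = suc k
  K = 32 * M * M
  d = suc q ∸ r
  expand : ∀ K M d → suc K * (16 * M * M * suc d) ≡ 16 * M * M * (suc K * d + suc K)
  expand = solve-∀
  regroup : ∀ q x → q + x + x ≡ q + 2 * x
  regroup = solve-∀
  double : ∀ M q → 16 * M * M * (q + q) ≡ 32 * M * M * q
  double = solve-∀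

[1+k]*N≤[2+k]*q² : ∀ k q → k + 2 ≤ q → suc k * N q ≤ suc (suc k) * (q * q)
[1+k]*N≤[2+k]*q² k q k+2≤q = begin
  suc k * (q * q + q + 1)          ≡⟨ expand k q ⟩
  suc k * (q * q) + (suc k + suc k * q) ≤⟨ +-monoʳ-≤ (suc k * (q * q)) (+-monoˡ-≤ (suc k * q) [1+k]≤q) ⟩
  suc k * (q * q) + (q + suc k * q) ≤⟨ +-monoʳ-≤ (suc k * (q * q)) (*-monoˡ-≤ q [2+k]≤q) ⟩
  suc k * (q * q) + q * q          ≡⟨ +-comm (suc k * (q * q)) (q * q) ⟩
  suc (suc k) * (q * q)            ∎
  where
  open ≤-Reasoning
  expand : ∀ k q → suc k * (q * q + q + 1) ≡ suc k * (q * q) + (suc k + suc k * q)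
  expand = solve-∀
  [2+k]≤q : suc (suc k) ≤ q
  [2+k]≤q = ≤-trans (≤-reflexive (+-comm 2 k)) k+2≤q
  [1+k]≤q : suc k ≤ q
  [1+k]≤q = ≤-trans (n≤1+n (suc k)) [2+k]≤q

theorem1 : (r : ℕ → ℕ) → (∀ q → 1 ≤ r q) →
    (∀ k → ∃[ Q ] ∀ q → Q ≤ q →
        (k * q ≤ suc k * r q) × (suc k * r q ≤ suc (suc k) * q)) →
    ∀ k → ∃[ Q ] ∀ q → Q ≤ q → 2 ≤ q → (Π : ProjectivePlane q) → ∀ m →
      IsMinPercolatingSize Π (r q) m →
      (k * (q * q) ≤ suc k * m) × (suc k * m ≤ suc (suc k) * (q * q))
theorem1 r _ r≈q k = proj₁ (r≈q K) + (2 * suc K + (k + 2)) , bounds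
  where
  K = 32 * suc k * suc k
  bounds : ∀ q → proj₁ (r≈q K) + (2 * suc K + (k + 2)) ≤ q → 2 ≤ q → (Π : ProjectivePlane q) → ∀ m →
    IsMinPercolatingSize Π (r q) m → (k * (q * q) ≤ suc k * m) × (suc k * m ≤ suc (suc k) * (q * q))
  bounds zero    _   ()
  bounds (suc p) Q≤q _  Π m ((A , A-percolates , ∣A∣≡m) , minimal) = lower , upper
    where
    open Percolation Π (r (suc p))
    q = suc p
    large = m+n≤o⇒n≤o (proj₁ (r≈q K)) Q≤q
    small : 16 * suc k * suc k * suc δ ≤ q
    small = deficiency-small k q (r q) (proj₁ (proj₂ (r≈q K) q (m+n≤o⇒m≤o _ Q≤q))) (m+n≤o⇒m≤o _ large)
    lower : k * (q * q) ≤ suc k * m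
    lower with percolation-stage (s≤s z≤n) A A-percolates (8 * suc k * suc δ * q) (s≤s z≤n)
    ... | L , u , cover , s₀≤u , sparse =
      subst (λ a → k * (q * q) ≤ suc k * a) ∣A∣≡m (k*q²≤[1+k]*a k p δ ∣ A ∣ L u small cover s₀≤u sparse)
    upper : suc k * m ≤ suc (suc k) * (q * q)
    upper = ≤-trans (*-monoʳ-≤ (suc k) (≤-trans (minimal ⊤ (0 , refl)) (≤-reflexive (∣⊤∣≡n (N q)))))
                    ([1+k]*N≤[2+k]*q² k q (m+n≤o⇒n≤o (2 * suc K) large))
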